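{- For every even positive integer $n$ there exists a cyclic and $\phi_n$-symmetric hamiltonian cycle system of $K_{2\times n}$.
   Context: $K_{m\times n}$ is the complete multipartite graph with $m$ parts of size $n$, with vertex set identified with $\mathbb{Z}_{mn}$, parts the cosets of $m\mathbb{Z}_{mn}$, and $x,y$ adjacent iff $x-y\notin m\mathbb{Z}_{mn}$ (here $m=2$). A hamiltonian cycle system is a set of hamiltonian cycles whose edge sets partition the edge set; it is cyclic if it is closed under adding $1$ to all vertices of a cycle. $\phi_n$ is the map $x\mapsto x+m$ on $\mathbb{Z}_{mn}$; the system is $\phi_n$-symmetric if each of its cycles is mapped to itself by $\phi_n$. -}

module Defs where

open import Data.Nat using (ℕ; zero; suc; _+_; _*_; _%_)
open import Data.Nat.DivMod using (m%n<n)
open import Data.Fin using (Fin; toℕ; fromℕ<)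
open import Data.Product using (Σ; ∃; _×_; _,_)
open import Data.Sum using (_⊎_)
open import Relation.Binary.PropositionalEquality using (_≡_; _≢_)
open import Relation.Nullary using (¬_)
open import Function.Bundles using (_⇔_)
open import Function.Definitions using (Injective)

_⊕_ : {N : ℕ} → Fin N → ℕ → Fin N
_⊕_ {suc k} x a = fromℕ< (m%n<n (toℕ x + a) (suc k))

nextIdx : {N : ℕ} → Fin N → Fin N
nextIdx i = i ⊕ 1

-- K_{m×n}: vertex set ℤ_{mn}; parts are the cosets of mℤ_{mn};
-- x ~ y iff x - y ∉ mℤ_{mn}.  Since m ∣ mn, x - y ∈ mℤ_{mn} iff
-- x ≡ y (mod m) as natural-number representatives, i.e. x + (mn - y) ≡ 0 mod m.
SamePart : (m n : ℕ) → Fin (m * n) → Fin (m * n) → Set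
SamePart m n x y = ∃ λ k → x ≡ y ⊕ (m * k)

Adj : (m n : ℕ) → Fin (m * n) → Fin (m * n) → Set
Adj m n x y = ¬ SamePart m n x y

-- A hamiltonian cycle of K_{m×n}, given as a cyclic vertex sequence
-- c 0, c 1, …, c (mn-1) (indices mod mn) visiting every vertex exactly once
-- (injective on the finite set Fin (mn), hence a bijection), with consecutive
-- vertices adjacent (including c (mn-1) ~ c 0).
record HamCycle (m n : ℕ) : Set where
  field
    seq       : Fin (m * n) → Fin (m * n)
    injective : Injective _≡_ _≡_ seq
    adjacent  : ∀ i → Adj m n (seq i) (seq (nextIdx i))
open HamCycle public

EdgeOf : {m n : ℕ} → HamCycle m n → Fin (m * n) → Fin (m * n) → Set
EdgeOf c x y = ∃ λ i → (seq c i ≡ x × seq c (nextIdx i) ≡ y)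
                     ⊎ (seq c i ≡ y × seq c (nextIdx i) ≡ x)

SameCycle : {m n : ℕ} → HamCycle m n → HamCycle m n → Set
SameCycle c d = ∀ x y → EdgeOf c x y ⇔ EdgeOf d x y

-- Image of a cycle under the translation x ↦ x + a.
-- (The translated sequence is again a hamiltonian cycle; we only need its
-- edge set, so we describe the translated cycle by its edges.)
EdgeOfShift : {m n : ℕ} → ℕ → HamCycle m n → Fin (m * n) → Fin (m * n) → Set
EdgeOfShift a c x y = ∃ λ i → (seq c i ⊕ a ≡ x × seq c (nextIdx i) ⊕ a ≡ y)
                            ⊎ (seq c i ⊕ a ≡ y × seq c (nextIdx i) ⊕ a ≡ x)

ShiftIs : {m n : ℕ} → ℕ → HamCycle m n → HamCycle m n → Set
ShiftIs a c d = ∀ x y → EdgeOfShift a c x y ⇔ EdgeOf d x y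

record HCS (m n : ℕ) : Set where
  field
    size   : ℕ
    cycle  : Fin size → HamCycle m n
    -- edges of cycles are edges of K_{m×n} (automatic from adjacency, kept
    -- implicit) and every edge of K_{m×n} is covered exactly once:
    partition : ∀ x y → Adj m n x y →
                Σ (Fin size) λ j → EdgeOf (cycle j) x y
                  × (∀ j′ → EdgeOf (cycle j′) x y → j′ ≡ j)
open HCS public

Cyclic : {m n : ℕ} → HCS m n → Set
Cyclic S = ∀ j → ∃ λ j′ → ShiftIs 1 (cycle S j) (cycle S j′)

PhiSymmetric : {m n : ℕ} → HCS m n → Set
PhiSymmetric {m} S = ∀ j → ShiftIs m (cycle S j) (cycle S j)

module Submission where

-- Write n = 2K and identify the vertices with ℤ_N, N = 2n = 4K; the two parts
-- are the even and the odd residues.  For j < K let D_j = {4j+1, 4j+3}; these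
-- sets partition the odd residues.  The cycle C_j visits σ_j 0, σ_j 1, …,
-- σ_j (N−1), where σ_j fixes even residues and adds 4j+2 to odd ones, so its
-- edges are exactly the pairs {a, a+d} with a even and d ∈ D_j (the links of
-- C_j).  Hence each edge {a, b} (a even, b odd) lies in exactly one cycle: the
-- C_j with b − a ∈ D_j.  Translation by 2 preserves the links of every C_j
-- (φ_n-symmetry), and translation by 1 sends the link {a, a+d} of C_j to
-- {a+d+1, a+d+1 + (N−d)} with N − d ∈ D_{K−1−j} (cyclicity).

open import Defs
open import Data.Nat using (ℕ; NonZero; zero; suc; pred; _+_; _*_; _%_; _/_; _<_; _≤_; s≤s; z≤n; s≤s⁻¹; parity)
open import Data.Nat.Properties
  using (+-comm; +-assoc; +-suc; +-identityʳ; ≤-antisym; <-≤-trans; <-trans; m<m+n; +-monoʳ-<; *-monoʳ-≤;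
         *-cancelˡ-<; m∸n≤m; m+[n∸m]≡n)
open import Data.Nat.DivMod
  using (m≡m%n+[m/n]*n; m%n%n≡m%n; %-distribˡ-+; [m+kn]%n≡m%n; [m+n]%n≡m%n; m%n<n; m<n⇒m%n≡m)
open import Data.Nat.Divisibility using (_∣_; divides)
open import Data.Nat.Tactic.RingSolver using (solve-∀)
open import Data.Parity.Base as ℙ using (Parity; 0ℙ; 1ℙ; _⁻¹)
open import Data.Parity.Properties as ℙ using (+-homo-+; *-homo-*; suc-homo-⁻¹)
open import Data.Fin using (Fin; toℕ; fromℕ<)
open import Data.Fin.Properties using (toℕ-injective; toℕ-fromℕ<; toℕ<n)
open import Data.Product using (Σ; ∃; _×_; _,_; proj₁; proj₂)
open import Data.Sum using (_⊎_; inj₁; inj₂)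
open import Data.Empty using (⊥; ⊥-elim)
open import Function.Bundles using (_⇔_; mk⇔; Equivalence)
open import Function.Properties.Equivalence using () renaming (trans to ⇔-trans; sym to ⇔-sym)
open import Relation.Binary.Bundles using (Setoid)
open import Relation.Binary.PropositionalEquality

parity-+ : ∀ a b {p q} → parity a ≡ p → parity b ≡ q → parity (a + b) ≡ p ℙ.+ q
parity-+ a b refl refl = +-homo-+ a b

parity-* : ∀ a b {p q} → parity a ≡ p → parity b ≡ q → parity (a * b) ≡ p ℙ.* q
parity-* a b refl refl = *-homo-* a b

opposite-parities : ∀ {p q : Parity} → p ≢ q → (p ≡ 0ℙ × q ≡ 1ℙ) ⊎ (p ≡ 1ℙ × q ≡ 0ℙ)
opposite-parities {0ℙ} {0ℙ} p≢q = ⊥-elim (p≢q refl)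
opposite-parities {0ℙ} {1ℙ} _   = inj₁ (refl , refl)
opposite-parities {1ℙ} {0ℙ} _   = inj₂ (refl , refl)
opposite-parities {1ℙ} {1ℙ} p≢q = ⊥-elim (p≢q refl)

parity-cases : ∀ a → parity a ≡ 0ℙ ⊎ parity a ≡ 1ℙ
parity-cases a with parity a
... | 0ℙ = inj₁ refl
... | 1ℙ = inj₂ refl

even⇒double : ∀ e → parity e ≡ 0ℙ → ∃ λ k → e ≡ 2 * k
even⇒double zero          _ = 0 , refl
even⇒double (suc (suc e)) p with even⇒double e p
... | k , refl = suc k , cong suc (sym (+-suc k (k + 0)))

-- The difference set of the j-th cycle: D_j = {4j+1, 4j+3}.  The sets D_j
-- (j ∈ ℕ) partition the odd numbers.
data Diff (j : ℕ) : ℕ → Set where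
  low  : Diff j (4 * j + 1)
  high : Diff j (4 * j + 3)

Diff-odd : ∀ {j d} → Diff j d → parity d ≡ 1ℙ
Diff-odd {j} low  = parity-+ (4 * j) 1 (*-homo-* 4 j) refl
Diff-odd {j} high = parity-+ (4 * j) 3 (*-homo-* 4 j) refl

quotient-bound : ∀ j {r} → r < 4 → 4 * j + r < 4 * suc j
quotient-bound j {r} r<4 = subst (4 * j + r <_) (four-suc j) (+-monoʳ-< (4 * j) r<4)
  where
  four-suc : ∀ j → 4 * j + 4 ≡ 4 * suc j
  four-suc = solve-∀

Diff-range : ∀ {j d} → Diff j d → 4 * j < d × d < 4 * suc j
Diff-range {j} low  = m<m+n (4 * j) (s≤s z≤n) , quotient-bound j (s≤s (s≤s z≤n))
Diff-range {j} high = m<m+n (4 * j) (s≤s z≤n) , quotient-bound j (s≤s (s≤s (s≤s (s≤s z≤n))))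

Diff-injective : ∀ {j j′ d} → Diff j d → Diff j′ d → j ≡ j′
Diff-injective δ δ′ = ≤-antisym (below δ δ′) (below δ′ δ)
  where
  below : ∀ {j j′ d} → Diff j d → Diff j′ d → j ≤ j′
  below {j} {j′} δ δ′ = s≤s⁻¹ (*-cancelˡ-< 4 j (suc j′) (<-trans (proj₁ (Diff-range δ)) (proj₂ (Diff-range δ′))))

Diff-bound : ∀ {K j d} → Diff j d → j < K ⇔ d < 4 * K
Diff-bound {K} {j} δ = mk⇔
  (λ j<K → <-≤-trans (proj₂ (Diff-range δ)) (*-monoʳ-≤ 4 j<K))
  (λ d<4K → *-cancelˡ-< 4 j K (<-trans (proj₁ (Diff-range δ)) d<4K))

four-step : ∀ j r → 4 * suc j + r ≡ 4 + (4 * j + r)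
four-step = solve-∀

Diff-step : ∀ {j d} → Diff j d → Diff (suc j) (4 + d)
Diff-step {j} low  = subst (Diff (suc j)) (four-step j 1) low
Diff-step {j} high = subst (Diff (suc j)) (four-step j 3) high

Diff-exists : ∀ d → parity d ≡ 1ℙ → ∃ λ j → Diff j d
Diff-exists 1 _ = 0 , low
Diff-exists 3 _ = 0 , high
Diff-exists (suc (suc (suc (suc d)))) odd with j , δ ← Diff-exists d odd = suc j , Diff-step δ

Diff-complement : ∀ {K j j′ d} → suc (j + j′) ≡ K → Diff j d →
                  ∃ λ d′ → Diff j′ d′ × d + d′ ≡ 4 * K
Diff-complement {j = j} {j′} refl low  = 4 * j′ + 3 , high , sum j j′
  where
  sum : ∀ j j′ → 4 * j + 1 + (4 * j′ + 3) ≡ 4 * suc (j + j′)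
  sum = solve-∀
Diff-complement {j = j} {j′} refl high = 4 * j′ + 1 , low , sum j j′
  where
  sum : ∀ j j′ → 4 * j + 3 + (4 * j′ + 1) ≡ 4 * suc (j + j′)
  sum = solve-∀

EdgeOf-sym : ∀ {m n} (c : HamCycle m n) {x y} → EdgeOf c x y → EdgeOf c y x
EdgeOf-sym c (i , inj₁ (e₁ , e₂)) = i , inj₂ (e₁ , e₂)
EdgeOf-sym c (i , inj₂ (e₁ , e₂)) = i , inj₁ (e₁ , e₂)

-- Congruence modulo N = M + 1 on natural-number representatives, and the
-- embedding of ℕ into ℤ_N = Fin N.  There is no subtraction: M * s represents −s.
module Congruence (M : ℕ) where
  N : ℕ
  N = suc M

  infix 4 _≈_
  record _≈_ (a b : ℕ) : Set where
    constructor mod≡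
    field mod-eq : a % N ≡ b % N
  open _≈_ public

  ≡⇒≈ : ∀ {a b} → a ≡ b → a ≈ b
  ≡⇒≈ refl = mod≡ refl

  ≈-setoid : Setoid _ _
  ≈-setoid = record
    { _≈_ = _≈_
    ; isEquivalence = record
      { refl  = mod≡ refl
      ; sym   = λ e → mod≡ (sym (mod-eq e))
      ; trans = λ e f → mod≡ (trans (mod-eq e) (mod-eq f)) } }

  open Setoid ≈-setoid public using () renaming (refl to ≈-refl; sym to ≈-sym; trans to ≈-trans)

  ≈-mod : ∀ a → a % N ≈ a
  ≈-mod a = mod≡ (m%n%n≡m%n a N)

  ≈-+ʳ : ∀ {a b} c → a ≈ b → a + c ≈ b + c
  ≈-+ʳ {a} {b} c (mod≡ e) = mod≡ (begin
    (a + c) % N          ≡⟨ %-distribˡ-+ a c N ⟩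
    (a % N + c % N) % N  ≡⟨ cong (λ t → (t + c % N) % N) e ⟩
    (b % N + c % N) % N  ≡⟨ %-distribˡ-+ b c N ⟨
    (b + c) % N          ∎)
    where open ≡-Reasoning

  ≈-+ˡ : ∀ c {a b} → a ≈ b → c + a ≈ c + b
  ≈-+ˡ c {a} {b} a≈b rewrite +-comm c a | +-comm c b = ≈-+ʳ c a≈b

  ≈-period : ∀ a → a + N ≈ a
  ≈-period a = mod≡ ([m+n]%n≡m%n a N)

  ≈-multiple : ∀ a k → a + k * N ≈ a
  ≈-multiple a k = mod≡ ([m+kn]%n≡m%n a k N)

  -- s + M * s is a multiple of N, so M * s acts as −s.
  ≈-negate : ∀ a s → a + s + M * s ≈ a
  ≈-negate a s = ≈-trans (≡⇒≈ (regroup a s M)) (≈-multiple a s)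
    where
    regroup : ∀ a s M → a + s + M * s ≡ a + s * suc M
    regroup = solve-∀

  ≈-cancelʳ : ∀ {a b} c → a + c ≈ b + c → a ≈ b
  ≈-cancelʳ {a} {b} c e = begin
    a                  ≈⟨ ≈-negate a c ⟨
    a + c + M * c      ≈⟨ ≈-+ʳ (M * c) e ⟩
    b + c + M * c      ≈⟨ ≈-negate b c ⟩
    b                  ∎
    where open import Relation.Binary.Reasoning.Setoid ≈-setoid

  ≈-cancelˡ : ∀ c {a b} → c + a ≈ c + b → a ≈ b
  ≈-cancelˡ c {a} {b} e rewrite +-comm c a | +-comm c b = ≈-cancelʳ c e

  ≈-shift : ∀ a b s → a + s ≈ b ⇔ a ≈ b + M * s
  ≈-shift a b s = mk⇔
    (λ e → ≈-trans (≈-sym (≈-negate a s)) (≈-+ʳ (M * s) e))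
    (λ e → ≈-cancelʳ (M * s) (≈-trans (≈-negate a s) e))

  ≈-canonical : ∀ {a b} → a < N → b < N → a ≈ b → a ≡ b
  ≈-canonical a<N b<N (mod≡ e) = trans (sym (m<n⇒m%n≡m a<N)) (trans e (m<n⇒m%n≡m b<N))

  ≈-parity : parity N ≡ 0ℙ → ∀ {a b} → a ≈ b → parity a ≡ parity b
  ≈-parity N-even {a} {b} (mod≡ e) = trans (reduce a) (trans (cong parity e) (sym (reduce b)))
    where
    open ≡-Reasoning
    reduce : ∀ a → parity a ≡ parity (a % N)
    reduce a = begin
      parity a                                     ≡⟨ cong parity (m≡m%n+[m/n]*n a N) ⟩
      parity (a % N + a / N * N)                   ≡⟨ parity-+ (a % N) (a / N * N) refl (parity-* (a / N) N refl N-even) ⟩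
      parity (a % N) ℙ.+ (parity (a / N) ℙ.* 0ℙ)   ≡⟨ cong (parity (a % N) ℙ.+_) (ℙ.*-zeroʳ (parity (a / N))) ⟩
      parity (a % N) ℙ.+ 0ℙ                        ≡⟨ ℙ.+-identityʳ (parity (a % N)) ⟩
      parity (a % N)                               ∎

  ⟦_⟧ : ℕ → Fin N
  ⟦ a ⟧ = fromℕ< (m%n<n a N)

  toℕ-⟦⟧ : ∀ a → toℕ ⟦ a ⟧ ≈ a
  toℕ-⟦⟧ a = ≈-trans (≡⇒≈ (toℕ-fromℕ< (m%n<n a N))) (≈-mod a)

  ⟦⟧-spec : ∀ a (x : Fin N) → ⟦ a ⟧ ≡ x ⇔ a ≈ toℕ x
  ⟦⟧-spec a x = mk⇔
    (λ { refl → ≈-sym (toℕ-⟦⟧ a) })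
    (λ e → toℕ-injective (trans (toℕ-fromℕ< (m%n<n a N)) (trans (mod-eq e) (m<n⇒m%n≡m (toℕ<n x)))))

  ⊕-spec : ∀ (x y : Fin N) s → x ⊕ s ≡ y ⇔ toℕ x + s ≈ toℕ y
  ⊕-spec x y s = ⟦⟧-spec (toℕ x + s) y

  toℕ-≈-injective : ∀ {x y : Fin N} → toℕ x ≈ toℕ y → x ≡ y
  toℕ-≈-injective {x} {y} e = toℕ-injective (≈-canonical (toℕ<n x) (toℕ<n y) e)

  ⊕-inverse : ∀ (x y : Fin N) s → x ⊕ s ≡ y ⇔ x ≡ y ⊕ (M * s)
  ⊕-inverse x y s =
    ⇔-trans (⊕-spec x y s)
    (⇔-trans (≈-shift (toℕ x) (toℕ y) s)
    (⇔-trans (mk⇔ ≈-sym ≈-sym)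
    (⇔-trans (⇔-sym (⊕-spec y x (M * s))) (mk⇔ sym sym))))

module Construction (k : ℕ) where
  K : ℕ
  K = suc k

  n : ℕ
  n = K * 2

  M : ℕ
  M = pred (2 * n)

  open Congruence M public

  N≡4K : N ≡ 4 * K
  N≡4K = quadruple k
    where
    quadruple : ∀ k → 2 * (suc k * 2) ≡ 4 * suc k
    quadruple = solve-∀

  N-even : parity N ≡ 0ℙ
  N-even = *-homo-* 2 n

  M-odd : parity M ≡ 1ℙ
  M-odd = trans (sym (suc-homo-⁻¹ M)) (cong _⁻¹ N-even)

  parity-≈ : ∀ {a b} → a ≈ b → parity a ≡ parity b
  parity-≈ = ≈-parity N-even

  diff : ℕ → ℕ → ℕ
  diff b a = b + M * a

  diff-spec : ∀ a b → a + diff b a ≈ b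
  diff-spec a b = ≈-trans (≡⇒≈ (regroup a b M)) (≈-negate b a)
    where
    regroup : ∀ a b M → a + (b + M * a) ≡ b + a + M * a
    regroup = solve-∀

  diff-parity : ∀ a b → parity (diff b a) ≡ parity b ℙ.+ parity a
  diff-parity a b = parity-+ b (M * a) refl (parity-* M a M-odd refl)

  SamePart⇔parity : ∀ x y → SamePart 2 n x y ⇔ parity (toℕ x) ≡ parity (toℕ y)
  SamePart⇔parity x y = mk⇔ to from
    where
    to : SamePart 2 n x y → parity (toℕ x) ≡ parity (toℕ y)
    to (h , x≡y+2h) = begin
      parity (toℕ x)                 ≡⟨ parity-≈ (Equivalence.to (⊕-spec y x (2 * h)) (sym x≡y+2h)) ⟨
      parity (toℕ y + 2 * h)         ≡⟨ parity-+ (toℕ y) (2 * h) refl (*-homo-* 2 h) ⟩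
      parity (toℕ y) ℙ.+ 0ℙ          ≡⟨ ℙ.+-identityʳ (parity (toℕ y)) ⟩
      parity (toℕ y)                 ∎
      where open ≡-Reasoning
    diff-even : parity (toℕ x) ≡ parity (toℕ y) → parity (diff (toℕ x) (toℕ y)) ≡ 0ℙ
    diff-even same = trans (diff-parity (toℕ y) (toℕ x))
                       (trans (cong (ℙ._+ parity (toℕ y)) same) (ℙ.p+p≡0ℙ (parity (toℕ y))))
    from : parity (toℕ x) ≡ parity (toℕ y) → SamePart 2 n x y
    from same with h , x−y≡2h ← even⇒double (diff (toℕ x) (toℕ y)) (diff-even same) =
      h , sym (Equivalence.from (⊕-spec y x (2 * h))
                 (≈-trans (≈-+ˡ (toℕ y) (≡⇒≈ (sym x−y≡2h))) (diff-spec (toℕ y) (toℕ x))))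

  -- Arc j a b: the cycle C_j joins the even vertex a to b = a + d, d ∈ D_j.
  Arc : ℕ → ℕ → ℕ → Set
  Arc j a b = parity a ≡ 0ℙ × ∃ λ d → Diff j d × b ≈ a + d

  Link : ℕ → ℕ → ℕ → Set
  Link j a b = Arc j a b ⊎ Arc j b a

  Arc-target-odd : ∀ {j a b} → Arc j a b → parity b ≡ 1ℙ
  Arc-target-odd {a = a} (a-even , d , δ , b≈a+d) = trans (parity-≈ b≈a+d) (parity-+ a d a-even (Diff-odd δ))

  Link-parity : ∀ {j a b} → Link j a b → parity a ≢ parity b
  Link-parity (inj₁ A@(a-even , _)) e with () ← trans (sym a-even) (trans e (Arc-target-odd A))
  Link-parity (inj₂ A@(b-even , _)) e with () ← trans (sym b-even) (trans (sym e) (Arc-target-odd A))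

  Link-sym : ∀ {j a b} → Link j a b → Link j b a
  Link-sym (inj₁ A) = inj₂ A
  Link-sym (inj₂ A) = inj₁ A

  Arc-cong : ∀ {j a a′ b b′} → a ≈ a′ → b ≈ b′ → Arc j a b → Arc j a′ b′
  Arc-cong a≈a′ b≈b′ (a-even , d , δ , b≈a+d) =
    trans (sym (parity-≈ a≈a′)) a-even , d , δ , ≈-trans (≈-sym b≈b′) (≈-trans b≈a+d (≈-+ʳ d a≈a′))

  Link-cong : ∀ {j a a′ b b′} → a ≈ a′ → b ≈ b′ → Link j a b → Link j a′ b′
  Link-cong a≈a′ b≈b′ (inj₁ A) = inj₁ (Arc-cong a≈a′ b≈b′ A)
  Link-cong a≈a′ b≈b′ (inj₂ A) = inj₂ (Arc-cong b≈b′ a≈a′ A)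

  Arc-translate : ∀ {j a b} t → parity t ≡ 0ℙ → Arc j a b ⇔ Arc j (a + t) (b + t)
  Arc-translate {j} {a} {b} t t-even = mk⇔ to from
    where
    swap : ∀ a d t → a + d + t ≡ a + t + d
    swap = solve-∀
    to : Arc j a b → Arc j (a + t) (b + t)
    to (a-even , d , δ , b≈a+d) =
      parity-+ a t a-even t-even , d , δ , ≈-trans (≈-+ʳ t b≈a+d) (≡⇒≈ (swap a d t))
    from : Arc j (a + t) (b + t) → Arc j a b
    from (a+t-even , d , δ , b+t≈a+t+d) =
      ℙ.+-cancelʳ-≡ 0ℙ (parity a) 0ℙ (trans (sym (parity-+ a t refl t-even)) a+t-even) ,
      d , δ , ≈-cancelʳ t (≈-trans b+t≈a+t+d (≡⇒≈ (sym (swap a d t))))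

  -- Translation by 1 reverses an arc of C_j into an arc of C_{j′}, j + j′ + 1 = K:
  -- the difference d ∈ D_j becomes N − d ∈ D_{j′}.
  Arc-reflect : ∀ {j j′ a b} → suc (j + j′) ≡ K → Arc j a b → Arc j′ (b + 1) (a + 1)
  Arc-reflect {a = a} {b} jj′ A@(a-even , d , δ , b≈a+d) with Diff-complement jj′ δ
  ... | d′ , δ′ , d+d′≡4K = parity-+ b 1 (Arc-target-odd A) refl , d′ , δ′ , ≈-sym (begin
    b + 1 + d′       ≈⟨ ≈-+ʳ d′ (≈-+ʳ 1 b≈a+d) ⟩
    a + d + 1 + d′   ≡⟨ regroup a d 1 d′ ⟩
    a + 1 + (d + d′) ≡⟨ cong (λ t → a + 1 + t) (trans d+d′≡4K (sym N≡4K)) ⟩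
    a + 1 + N        ≈⟨ ≈-period (a + 1) ⟩
    a + 1            ∎)
    where
    open import Relation.Binary.Reasoning.Setoid ≈-setoid
    regroup : ∀ a d u d′ → a + d + u + d′ ≡ a + u + (d + d′)
    regroup = solve-∀

  Link-translate : ∀ {j a b} t → parity t ≡ 0ℙ → Link j a b ⇔ Link j (a + t) (b + t)
  Link-translate t t-even = mk⇔
    (λ { (inj₁ A) → inj₁ (Equivalence.to (Arc-translate t t-even) A)
       ; (inj₂ A) → inj₂ (Equivalence.to (Arc-translate t t-even) A) })
    (λ { (inj₁ A) → inj₁ (Equivalence.from (Arc-translate t t-even) A)
       ; (inj₂ A) → inj₂ (Equivalence.from (Arc-translate t t-even) A) })

  Link-reflect : ∀ {j j′ a b} → suc (j + j′) ≡ K → Link j a b ⇔ Link j′ (a + 1) (b + 1)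
  Link-reflect {j} {j′} {a} {b} jj′ = mk⇔ (reflect jj′) back
    where
    reflect : ∀ {i i′ a b} → suc (i + i′) ≡ K → Link i a b → Link i′ (a + 1) (b + 1)
    reflect ii′ (inj₁ A) = inj₂ (Arc-reflect ii′ A)
    reflect ii′ (inj₂ A) = inj₁ (Arc-reflect ii′ A)
    -- reflecting twice is translation by 2
    back : Link j′ (a + 1) (b + 1) → Link j a b
    back L = Equivalence.from (Link-translate 2 refl)
               (subst₂ (Link j) (+-assoc a 1 1) (+-assoc b 1 1)
                 (reflect (trans (cong suc (+-comm j′ j)) jj′) L))

  Arc-exists : ∀ {a b} → parity a ≡ 0ℙ → parity b ≡ 1ℙ → ∃ λ j → j < K × Arc j a b
  Arc-exists {a} {b} a-even b-odd with Diff-exists (diff b a % N) d-odd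
    where
    d-odd : parity (diff b a % N) ≡ 1ℙ
    d-odd = trans (parity-≈ (≈-mod (diff b a))) (trans (diff-parity a b) (cong₂ ℙ._+_ b-odd a-even))
  ... | j , δ = j , Equivalence.from (Diff-bound δ) (subst (diff b a % N <_) N≡4K (m%n<n (diff b a) N)) ,
                a-even , diff b a % N , δ , ≈-sym (≈-trans (≈-+ˡ a (≈-mod (diff b a))) (diff-spec a b))

  Arc-unique : ∀ {j j′ a b} → j < K → j′ < K → Arc j a b → Arc j′ a b → j ≡ j′
  Arc-unique {j′ = j′} {a} j<K j′<K (_ , d , δ , b≈a+d) (_ , d′ , δ′ , b≈a+d′) =
    Diff-injective δ (subst (Diff j′) (sym d≡d′) δ′)
    where
    below-N : ∀ {i e} → i < K → Diff i e → e < N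
    below-N {e = e} i<K ε = subst (e <_) (sym N≡4K) (Equivalence.to (Diff-bound ε) i<K)
    d≡d′ : d ≡ d′
    d≡d′ = ≈-canonical (below-N j<K δ) (below-N j′<K δ′) (≈-cancelˡ a (≈-trans (≈-sym b≈a+d) b≈a+d′))

  -- An edge cannot be an arc in both directions: its source is even, its target odd.
  Arc-antisym : ∀ {j j′ a b} → Arc j a b → Arc j′ b a → ⊥
  Arc-antisym (a-even , _) A′ with () ← trans (sym a-even) (Arc-target-odd A′)

  Link-unique : ∀ {j j′ a b} → j < K → j′ < K → Link j a b → Link j′ a b → j ≡ j′
  Link-unique j<K j′<K (inj₁ A) (inj₁ A′) = Arc-unique j<K j′<K A A′
  Link-unique j<K j′<K (inj₂ A) (inj₂ A′) = Arc-unique j<K j′<K A A′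
  Link-unique j<K j′<K (inj₁ A) (inj₂ A′) = ⊥-elim (Arc-antisym A A′)
  Link-unique j<K j′<K (inj₂ A) (inj₁ A′) = ⊥-elim (Arc-antisym A′ A)

  offset : ℕ → Parity → ℕ
  offset j 0ℙ = 0
  offset j 1ℙ = 4 * j + 2

  σ : ℕ → ℕ → ℕ
  σ j a = a + offset j (parity a)

  σ-even : ∀ j a → parity a ≡ 0ℙ → σ j a ≡ a
  σ-even j a a-even = trans (cong (λ p → a + offset j p) a-even) (+-identityʳ a)

  σ-odd : ∀ j a → parity a ≡ 1ℙ → σ j a ≡ a + (4 * j + 2)
  σ-odd j a a-odd = cong (λ p → a + offset j p) a-odd

  σ-parity : ∀ j a → parity (σ j a) ≡ parity a
  σ-parity j a = trans (parity-+ a (offset j (parity a)) refl (offset-even (parity a))) (ℙ.+-identityʳ (parity a))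
    where
    offset-even : ∀ p → parity (offset j p) ≡ 0ℙ
    offset-even 0ℙ = refl
    offset-even 1ℙ = parity-+ (4 * j) 2 (*-homo-* 4 j) refl

  σ-cong : ∀ j {a b} → a ≈ b → σ j a ≈ σ j b
  σ-cong j {a} {b} a≈b =
    ≈-trans (≈-+ʳ (offset j (parity a)) a≈b) (≡⇒≈ (cong (λ p → b + offset j p) (parity-≈ a≈b)))

  σ-injective : ∀ j {a b} → σ j a ≈ σ j b → a ≈ b
  σ-injective j {a} {b} σa≈σb =
    ≈-cancelʳ (offset j (parity a)) (≈-trans σa≈σb (≡⇒≈ (cong (λ p → b + offset j p) (sym same-parity))))
    where
    same-parity : parity a ≡ parity b
    same-parity = trans (sym (σ-parity j a)) (trans (parity-≈ σa≈σb) (σ-parity j b))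

  σ-after-even : ∀ j a → parity a ≡ 0ℙ → σ j (a + 1) ≡ a + (4 * j + 3)
  σ-after-even j a a-even = trans (σ-odd j (a + 1) (parity-+ a 1 a-even refl)) (regroup a j)
    where
    regroup : ∀ a j → a + 1 + (4 * j + 2) ≡ a + (4 * j + 3)
    regroup = solve-∀

  σ-step : ∀ j a → Link j (σ j a) (σ j (a + 1))
  σ-step j a with parity-cases a
  ... | inj₁ a-even = inj₁ (Arc-cong (≡⇒≈ (sym (σ-even j a a-even))) (≡⇒≈ (sym (σ-after-even j a a-even)))
                              (a-even , 4 * j + 3 , high , ≈-refl))
  ... | inj₂ a-odd = inj₂ (Arc-cong σa+1 σa (parity-+ a 1 a-odd refl , 4 * j + 1 , low , ≡⇒≈ (regroup a j)))
    where
    σa : a + (4 * j + 2) ≈ σ j a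
    σa = ≡⇒≈ (sym (σ-odd j a a-odd))
    σa+1 : a + 1 ≈ σ j (a + 1)
    σa+1 = ≡⇒≈ (sym (σ-even j (a + 1) (parity-+ a 1 a-odd refl)))
    regroup : ∀ a j → a + (4 * j + 2) ≡ a + 1 + (4 * j + 1)
    regroup = solve-∀

  σ-realises : ∀ {j a b} → Arc j a b →
               ∃ λ i → (σ j i ≈ a × σ j (i + 1) ≈ b) ⊎ (σ j i ≈ b × σ j (i + 1) ≈ a)
  σ-realises {j} {a} {b} (a-even , .(4 * j + 3) , high , b≈a+d) =
    a , inj₁ (≡⇒≈ (σ-even j a a-even) , ≈-trans (≡⇒≈ (σ-after-even j a a-even)) (≈-sym b≈a+d))
  σ-realises {j} {a} {b} (a-even , .(4 * j + 1) , low , b≈a+d) =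
    a + M , inj₂ (σ-pred , σ-self)
    -- the arc {a, a + 4j + 1} is the step from position a − 1 (odd) to position a
    where
    pred-odd : parity (a + M) ≡ 1ℙ
    pred-odd = parity-+ a M a-even M-odd
    regroup₁ : ∀ a j M → a + M + (4 * j + 2) ≡ a + (4 * j + 1) + suc M
    regroup₁ = solve-∀
    regroup₂ : ∀ a M → a + M + 1 ≡ a + suc M
    regroup₂ = solve-∀
    σ-pred : σ j (a + M) ≈ b
    σ-pred = ≈-trans (≡⇒≈ (trans (σ-odd j (a + M) pred-odd) (regroup₁ a j M)))
               (≈-trans (≈-period (a + (4 * j + 1))) (≈-sym b≈a+d))
    σ-self : σ j (a + M + 1) ≈ a
    σ-self = ≈-trans (≡⇒≈ (trans (σ-even j (a + M + 1) (parity-+ (a + M) 1 pred-odd refl)) (regroup₂ a M))) (≈-period a)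

  walk : ℕ → Fin N → Fin N
  walk j i = ⟦ σ j (toℕ i) ⟧

  walk-step : ∀ j i → Link j (toℕ (walk j i)) (toℕ (walk j (nextIdx i)))
  walk-step j i = Link-cong (≈-sym (toℕ-⟦⟧ _)) (≈-sym σ-next) (σ-step j (toℕ i))
    where
    σ-next : toℕ (walk j (nextIdx i)) ≈ σ j (toℕ i + 1)
    σ-next = ≈-trans (toℕ-⟦⟧ _) (σ-cong j (toℕ-⟦⟧ (toℕ i + 1)))

  C : ℕ → HamCycle 2 n
  C j = record
    { seq       = walk j
    ; injective = λ e → toℕ-≈-injective (σ-injective j
                    (≈-trans (≈-sym (toℕ-⟦⟧ _)) (≈-trans (≡⇒≈ (cong toℕ e)) (toℕ-⟦⟧ _))))
    ; adjacent  = λ i same → Link-parity (walk-step j i)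
                    (Equivalence.to (SamePart⇔parity (walk j i) (walk j (nextIdx i))) same)
    }

  record Describes (c : HamCycle 2 n) (R : ℕ → ℕ → Set) : Set where
    constructor describes
    field edge⇔ : ∀ x y → EdgeOf c x y ⇔ R (toℕ x) (toℕ y)
  open Describes

  C-edges : ∀ j → Describes (C j) (Link j)
  C-edges j = describes λ x y → mk⇔ to from
    where
    to : ∀ {x y} → EdgeOf (C j) x y → Link j (toℕ x) (toℕ y)
    to (i , inj₁ (e₁ , e₂)) = subst₂ (λ u v → Link j (toℕ u) (toℕ v)) e₁ e₂ (walk-step j i)
    to (i , inj₂ (e₁ , e₂)) = Link-sym (subst₂ (λ u v → Link j (toℕ u) (toℕ v)) e₁ e₂ (walk-step j i))
    visits : ∀ i (z : Fin N) → σ j i ≈ toℕ z → walk j ⟦ i ⟧ ≡ z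
    visits i z e = Equivalence.from (⟦⟧-spec _ z) (≈-trans (σ-cong j (toℕ-⟦⟧ i)) e)
    visits-next : ∀ i (z : Fin N) → σ j (i + 1) ≈ toℕ z → walk j (nextIdx ⟦ i ⟧) ≡ z
    visits-next i z e = Equivalence.from (⟦⟧-spec _ z)
      (≈-trans (σ-cong j (≈-trans (toℕ-⟦⟧ (toℕ ⟦ i ⟧ + 1)) (≈-+ʳ 1 (toℕ-⟦⟧ i)))) e)
    arc-edge : ∀ {x y} → Arc j (toℕ x) (toℕ y) → EdgeOf (C j) x y
    arc-edge {x} {y} A with σ-realises A
    ... | i , inj₁ (σi≈x , σi+1≈y) = ⟦ i ⟧ , inj₁ (visits i x σi≈x , visits-next i y σi+1≈y)
    ... | i , inj₂ (σi≈y , σi+1≈x) = ⟦ i ⟧ , inj₂ (visits i y σi≈y , visits-next i x σi+1≈x)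
    from : ∀ {x y} → Link j (toℕ x) (toℕ y) → EdgeOf (C j) x y
    from (inj₁ A) = arc-edge A
    from (inj₂ A) = EdgeOf-sym (C j) (arc-edge A)

  EdgeOfShift⇔ : ∀ s (c : HamCycle 2 n) x y → EdgeOfShift s c x y ⇔ EdgeOf c (x ⊕ (M * s)) (y ⊕ (M * s))
  EdgeOfShift⇔ s c x y = mk⇔
    (λ { (i , inj₁ (e₁ , e₂)) → i , inj₁ (to e₁ , to e₂) ; (i , inj₂ (e₁ , e₂)) → i , inj₂ (to e₁ , to e₂) })
    (λ { (i , inj₁ (e₁ , e₂)) → i , inj₁ (from e₁ , from e₂) ; (i , inj₂ (e₁ , e₂)) → i , inj₂ (from e₁ , from e₂) })
    where
    to : ∀ {u z} → u ⊕ s ≡ z → u ≡ z ⊕ (M * s)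
    to {u} {z} = Equivalence.to (⊕-inverse u z s)
    from : ∀ {u z} → u ≡ z ⊕ (M * s) → u ⊕ s ≡ z
    from {u} {z} = Equivalence.from (⊕-inverse u z s)

  ShiftIs-described : ∀ s {c d R R′} → Describes c R → Describes d R′ →
                      (∀ {a a′ b b′} → a ≈ a′ → b ≈ b′ → R′ a b → R′ a′ b′) →
                      (∀ a b → R a b ⇔ R′ (a + s) (b + s)) → ShiftIs s c d
  ShiftIs-described s {c} {d} c-edges d-edges R′-cong R⇔R′ x y =
    ⇔-trans (EdgeOfShift⇔ s c x y)
    (⇔-trans (edge⇔ c-edges x′ y′)
    (⇔-trans (R⇔R′ (toℕ x′) (toℕ y′))
    (⇔-trans (mk⇔ (R′-cong (back x) (back y)) (R′-cong (≈-sym (back x)) (≈-sym (back y))))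
    (⇔-sym (edge⇔ d-edges x y)))))
    where
    x′ y′ : Fin N
    x′ = x ⊕ (M * s)
    y′ = y ⊕ (M * s)
    back : ∀ z → toℕ (z ⊕ (M * s)) + s ≈ toℕ z
    back z = Equivalence.to (⊕-spec (z ⊕ (M * s)) z s) (Equivalence.from (⊕-inverse (z ⊕ (M * s)) z s) refl)

  link-exists : ∀ {a b} → parity a ≢ parity b → ∃ λ j → j < K × Link j a b
  link-exists a≢b with opposite-parities a≢b
  ... | inj₁ (a-even , b-odd) with j , j<K , A ← Arc-exists a-even b-odd = j , j<K , inj₁ A
  ... | inj₂ (a-odd , b-even) with j , j<K , A ← Arc-exists b-even a-odd = j , j<K , inj₂ A

  system : HCS 2 n
  system = record { size = K ; cycle = λ j → C (toℕ j) ; partition = unique-cover }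
    where
    unique-cover : ∀ x y → Adj 2 n x y → Σ (Fin K) λ j → EdgeOf (C (toℕ j)) x y
                  × (∀ j′ → EdgeOf (C (toℕ j′)) x y → j′ ≡ j)
    unique-cover x y adj with j , j<K , L ← link-exists (λ same → adj (Equivalence.from (SamePart⇔parity x y) same)) =
      fromℕ< j<K , edge , unique
      where
      index : toℕ (fromℕ< j<K) ≡ j
      index = toℕ-fromℕ< j<K
      edge : EdgeOf (C (toℕ (fromℕ< j<K))) x y
      edge = Equivalence.from (edge⇔ (C-edges _) x y) (subst (λ i → Link i (toℕ x) (toℕ y)) (sym index) L)
      unique : ∀ j′ → EdgeOf (C (toℕ j′)) x y → j′ ≡ fromℕ< j<K
      unique j′ E = toℕ-injective
        (trans (Link-unique (toℕ<n j′) j<K (Equivalence.to (edge⇔ (C-edges (toℕ j′)) x y) E) L) (sym index))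

  cyclic : Cyclic system
  cyclic j = partner , ShiftIs-described 1 (C-edges (toℕ j)) (C-edges (toℕ partner))
                         Link-cong (λ _ _ → Link-reflect complementary)
    where
    partner : Fin K
    partner = fromℕ< (s≤s (m∸n≤m k (toℕ j)))
    complementary : suc (toℕ j + toℕ partner) ≡ K
    complementary = cong suc (trans (cong (toℕ j +_) (toℕ-fromℕ< (s≤s (m∸n≤m k (toℕ j)))))
                                    (m+[n∸m]≡n (s≤s⁻¹ (toℕ<n j))))

  symmetric : PhiSymmetric system
  symmetric j = ShiftIs-described 2 (C-edges (toℕ j)) (C-edges (toℕ j))
                  Link-cong (λ _ _ → Link-translate 2 refl)

proposition4p2 : (n : ℕ) → NonZero n → 2 ∣ n →
    Σ (HCS 2 n) λ S → Cyclic S × PhiSymmetric S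
proposition4p2 .(0 * 2)     ()  (divides zero refl)
proposition4p2 .(suc k * 2) _   (divides (suc k) refl) =
  Construction.system k , Construction.cyclic k , Construction.symmetric k
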